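{- Let $f_1 f_2 \cdots f_z$ be the LZ-End parsing of a string and let $j < z$. Then for every $k \in [1..j)$, the longest common suffix of the strings $f_1 f_2 \cdots f_j$ and $f_1 f_2 \cdots f_k$ has length less than $|f_j|$. Equivalently, if a compressed trie $T$ stores exactly the reversed strings $\overleftarrow{f_1}, \overleftarrow{f_1 f_2}, \ldots, \overleftarrow{f_1 f_2 \cdots f_{j-1}}$, then the longest prefix of $\overleftarrow{f_1 f_2 \cdots f_j}$ that is a prefix of some string stored in $T$ has length less than $|f_j|$.
   Context: For a string $w$, $\overleftarrow{w} = w[|w|]\cdots w[2]w[1]$ is its reversal, and $w[i..j] = w[i]\cdots w[j]$. The LZ-End parsing of $s$ is the decomposition $s = f_1 f_2 \cdots f_z$ built greedily from left to right: if a prefix $s[1..k] = f_1 f_2\cdots f_{i-1}$ has already been parsed, then $f_i[1..|f_i|-1]$ is the longest prefix of $s[k+1..|s|-1]$ that is a suffix of some string $f_1 f_2 \cdots f_j$ with $j < i$ (the empty string counts as such a suffix), and $f_i$ is this prefix extended by the next letter of $s$. The substrings $f_i$ are called phrases. -}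

module Defs where

open import Data.Nat using (ℕ; zero; suc; _≤_; _<_)
open import Data.List using (List; []; _∷_; _++_; [_]; length; concat; take; _∷ʳ_)
open import Data.Product using (Σ; ∃; _×_; _,_)
open import Data.Empty using (⊥)
open import Data.Unit using (⊤)
open import Relation.Binary.PropositionalEquality using (_≡_)

IsSuffix : {A : Set} → List A → List A → Set
IsSuffix v x = ∃ λ p → p ++ v ≡ x

IsPrefixOfInit : {A : Set} → List A → List A → Set
IsPrefixOfInit v r = ∃ λ w → ∃ λ d → r ≡ v ++ w ++ [ d ]

-- v is a suffix of f_1 ⋯ f_j for some j with 0 ≤ j ≤ |done|,
-- where done = f_1 ⋯ f_{i-1} are the phrases already produced
-- (j = 0 gives the empty string, so the empty string always counts).
Candidate : {A : Set} → List (List A) → List A → Set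
Candidate done v = ∃ λ j → j ≤ length done × IsSuffix v (concat (take j done))

-- ValidFrom done rest fs : the phrases fs are the LZ-End phrases produced
-- greedily for the remaining suffix `rest`, given already produced phrases `done`.
ValidFrom : {A : Set} → List (List A) → List A → List (List A) → Set
ValidFrom done [] [] = ⊤
ValidFrom done (_ ∷ _) [] = ⊥
ValidFrom done rest (f ∷ fs) =
  Σ _ λ u → Σ _ λ c → Σ _ λ rest' →
    (rest ≡ u ++ c ∷ rest')
  × (f ≡ u ++ [ c ])
  × IsPrefixOfInit u rest
  × Candidate done u
  × (∀ v → IsPrefixOfInit v rest → Candidate done v → length v ≤ length u)
  × ValidFrom (done ∷ʳ f) rest' fs

IsLZEndParsing : {A : Set} → List A → List (List A) → Set
IsLZEndParsing s fs = ValidFrom [] s fs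

-- If the common suffix were at least |f_j| long, f_j would itself be a suffix of
-- f_1 ⋯ f_k with k < j. But f_j = u c where u is the longest admissible extension,
-- and since f_j is not the last phrase, u c is still a prefix of the remaining
-- input without its last letter. So u c would be a longer admissible candidate,
-- contradicting the greedy choice of u.
module Submission where

open import Defs
open import Data.Nat using (ℕ; suc; _≤_; _<_; _≤?_; s≤s; z<s)
open import Data.Nat.Properties using (<⇒≤; <⇒≱; ≰⇒>; m<m+n; m≤n⇒m⊓n≡m)
open import Data.Fin using (Fin; zero; suc; toℕ)
open import Data.List using (List; []; _∷_; _++_; [_]; _∷ʳ_; length; concat; take; lookup; initLast; _∷ʳ′_)
open import Data.List.Properties
  using (++-assoc; ++-identityʳ; ++-conicalʳ; ∷-injectiveʳ; length-++; length-++-≤ʳ; concat-++; take-suc; take-take; length-take)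
open import Data.Product using (∃; _,_)
open import Relation.Nullary using (¬_; yes; no; contradiction)
open import Relation.Binary.PropositionalEquality using (_≡_; _≢_; refl; sym; trans; cong; subst)

private
  variable
    A : Set
    done : List (List A)
    rest f f′ u v w : List A
    fs : List (List A)

IsSuffix-trans : IsSuffix u v → IsSuffix v w → IsSuffix u w
IsSuffix-trans {u = u} (p , refl) (q , refl) = q ++ p , ++-assoc q p u

shorter-suffix-is-suffix : (p q : List A) → p ++ u ≡ q ++ v → length u ≤ length v → IsSuffix u v
shorter-suffix-is-suffix p       []      eq   _   = p , eq
shorter-suffix-is-suffix []      (y ∷ q) refl u≤v = contradiction u≤v (<⇒≱ (s≤s (length-++-≤ʳ _ {q})))
shorter-suffix-is-suffix (x ∷ p) (y ∷ q) eq   u≤v = shorter-suffix-is-suffix p q (∷-injectiveʳ eq) u≤v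

concat-∷ʳ : (xss : List (List A)) (ys : List A) → concat (xss ∷ʳ ys) ≡ concat xss ++ ys
concat-∷ʳ xss ys = trans (sym (concat-++ xss [ ys ])) (cong (concat xss ++_) (++-identityʳ ys))

-- ValidFrom only unfolds once the remaining input is known to be [] or a cons.
ValidFrom-∷⇒≢[] : ValidFrom done rest (f ∷ fs) → rest ≢ []
ValidFrom-∷⇒≢[] {rest = []}    (u , c , rest′ , rest≡ , _) _ with () ← ++-conicalʳ u (c ∷ rest′) (sym rest≡)
ValidFrom-∷⇒≢[] {rest = _ ∷ _} _ ()

ValidFrom-tail : ValidFrom done rest (f ∷ fs) → ∃ λ rest′ → ValidFrom (done ∷ʳ f) rest′ fs
ValidFrom-tail {rest = []}    valid = contradiction refl (ValidFrom-∷⇒≢[] valid)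
ValidFrom-tail {rest = _ ∷ _} (_ , _ , rest′ , _ , _ , _ , _ , _ , next) = rest′ , next

nonfinal-phrase-not-candidate : ValidFrom done rest (f ∷ f′ ∷ fs) → ¬ Candidate done f
nonfinal-phrase-not-candidate {rest = []} valid = contradiction refl (ValidFrom-∷⇒≢[] valid)
nonfinal-phrase-not-candidate {rest = rest@(_ ∷ _)} (u , c , rest′ , rest≡ , refl , _ , _ , longest , next) candidate
  with initLast rest′
... | []        = ValidFrom-∷⇒≢[] next refl
... | xs ∷ʳ′ d  = <⇒≱ u<uc (longest (u ++ [ c ]) uc-prefix candidate)
  where
  u<uc : length u < length (u ++ [ c ])
  u<uc = subst (length u <_) (sym (length-++ u)) (m<m+n (length u) z<s)
  uc-prefix : IsPrefixOfInit (u ++ [ c ]) rest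
  uc-prefix = xs , d , trans rest≡ (sym (++-assoc u [ c ] (xs ∷ʳ d)))

nonfinal-phrases-not-candidates : ValidFrom done rest fs → (j : Fin (length fs)) → suc (toℕ j) < length fs →
  ¬ Candidate (done ++ take (toℕ j) fs) (lookup fs j)
nonfinal-phrases-not-candidates {done = done} {fs = _ ∷ _ ∷ _} valid zero _ =
  subst (λ prev → ¬ Candidate prev _) (sym (++-identityʳ done)) (nonfinal-phrase-not-candidate valid)
nonfinal-phrases-not-candidates {done = done} {fs = f ∷ fs} valid (suc j) (s≤s j<) with _ , next ← ValidFrom-tail valid =
  subst (λ prev → ¬ Candidate prev _) (++-assoc done [ f ] (take (toℕ j) fs))
    (nonfinal-phrases-not-candidates next j j<)

common-suffix-shorter : ¬ Candidate done f → (k : ℕ) → k ≤ length done →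
  IsSuffix w (concat done ++ f) → IsSuffix w (concat (take k done)) → length w < length f
common-suffix-shorter {f = f} {w = w} not-candidate k k≤ (p , p≡) w-suffix with length f ≤? length w
... | no  f≰w = ≰⇒> f≰w
... | yes f≤w = contradiction (k , k≤ , IsSuffix-trans f-suffix w-suffix) not-candidate
  where
  f-suffix : IsSuffix f w
  f-suffix = shorter-suffix-is-suffix _ p (sym p≡) f≤w

lemma9 : {A : Set} (s : List A) (fs : List (List A)) → IsLZEndParsing s fs →
    (j : Fin (length fs)) → suc (toℕ j) < length fs →
    (k : ℕ) → 1 ≤ k → k < suc (toℕ j) →
    (w : List A) → IsSuffix w (concat (take (suc (toℕ j)) fs)) →
    IsSuffix w (concat (take k fs)) →
    length w < length (lookup fs j)
lemma9 s fs parsing j j< k _ (s≤s k≤j) w w-suffix-j w-suffix-k =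
  common-suffix-shorter (nonfinal-phrases-not-candidates parsing j j<) k k≤prev
    (subst (IsSuffix w) prefix-j≡ w-suffix-j)
    (subst (IsSuffix w) prefix-k≡ w-suffix-k)
  where
  m : ℕ
  m = toℕ j
  prefix-j≡ : concat (take (suc m) fs) ≡ concat (take m fs) ++ lookup fs j
  prefix-j≡ = trans (cong concat (take-suc fs j)) (concat-∷ʳ (take m fs) (lookup fs j))
  prefix-k≡ : concat (take k fs) ≡ concat (take k (take m fs))
  prefix-k≡ = cong concat (trans (cong (λ n → take n fs) (sym (m≤n⇒m⊓n≡m k≤j))) (sym (take-take k m fs)))
  k≤prev : k ≤ length (take m fs)
  k≤prev = subst (k ≤_) (sym (trans (length-take m fs) (m≤n⇒m⊓n≡m (<⇒≤ (<⇒≤ j<))))) k≤j
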